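{- The QCNFs $\mathtt{Trapdoor}_n$ have polynomial-size $\mathsf{QCDCL}^{\textsf{LEV-ORD}}_{\textsf{NO-RED}}$ refutations.
   Context: $\mathtt{PHP}^{n+1}_n$ is the CNF in variables $x_{i,j}$ ($i\in[n+1]$, $j\in[n]$) with clauses $\bigvee_{k\in[n]}x_{i,k}$ and $\bar x_{i_1,j}\vee\bar x_{i_2,j}$ ($i_1\ne i_2$). Let $s_n=n(n+1)$, variables renamed $x_1,\dots,x_{s_n}$. $\mathtt{Trapdoor}_n$ is the QCNF with prefix $\exists y_1,\dots,y_{s_n}\,\forall w\,\exists t,x_1,\dots,x_{s_n}\,\forall u$ and matrix $\mathtt{PHP}^{n+1}_n(x_1,\dots,x_{s_n})$ together with, for each $i\in[s_n]$: $\bar y_i\vee x_i\vee u$, $y_i\vee\bar x_i\vee u$, $y_i\vee w\vee t$, $y_i\vee w\vee\bar t$, $\bar y_i\vee w\vee t$, $\bar y_i\vee w\vee\bar t$. Notions. For a QCNF $\Phi=\mathcal{Q}\cdot\phi$ with prefix $Q_1X_1\dots Q_sX_s$, $\mathrm{lv}(x)=i$ if the variable of $x$ is in $X_i$. $\mathrm{red}(C)$ deletes from $C$ every universal literal $v$ with $\mathrm{lv}(v)>\mathrm{lv}(x)$ for all existential $x\in C$; $(C_1\vee\ell)\otimes_\ell(C_2\vee\bar\ell)=C_1\vee C_2$ for existential $\ell$. $C|_\sigma=\top$ if $C\cap\sigma\neq\emptyset$, else the clause of $\ell\in C$ with $\bar\ell\notin\sigma$. A trail is $\mathcal{T}=(p_{(0,1)},\dots,p_{(0,g_0)};d_1,p_{(1,1)},\dots;\dots;d_r,\dots,p_{(r,g_r)})$,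 a sequence of literals with no variable occurring twice; $d_i$ decisions, $p_{(i,j)}$ propagated literals (existential, or $\bot$ only as last element: a conflict); $\mathcal{T}[s,t]$ is the initial segment ending at $p_{(s,t)}$ (at $d_s$ if $t=0$; $\mathcal{T}[0,0]$ empty); $|\mathcal{T}|$ its length. NO-RED: each $p_{(i,j)}$ has antecedent $\mathrm{ante}(p_{(i,j)})$ in the current clause set with $\mathrm{ante}(p_{(i,j)})|_{\mathcal{T}[i,j-1]}=(p_{(i,j)})$ ($(\bot)$ = empty clause). LEV-ORD: $\mathrm{lv}(d_i)\le\mathrm{lv}(x)$ for all variables $x$ unassigned in $\mathcal{T}[i-1,g_{i-1}]$. A clause $C$ is unit if $C=(x)$ with $x$ existential or $C$ empty. Natural condition at an initial segment without $\bot$: if some clauses are unit under it, the next element is the literal of one of them with that clause as antecedent, and is $\bot$ if possible. Learnable clauses of a trail ending in $\bot$: start with $\mathrm{red}(\mathrm{ante}(\bot))$, go leftwards over propagated $p$: current $C'$ becomes $\mathrm{red}(C'\otimes_p\mathrm{red}(\mathrm{ante}(p)))$ if $\bar p\in C'$, else stays; $\mathcal{L}_\mathcal{T}$ is this sequence. A $\mathsf{QCDCL}^{\textsf{LEV-ORD}}_{\textsf{NO-RED}}$ refutation of $\Phi$: trails $\mathcal{T}_1,\dots,\mathcal{T}_m$ and clauses $C_1,\dots,C_m=(\bot)$ (with derivations), $\mathcal{T}_i$ a LEV-ORD/NO-RED trail for $\mathcal{Q}\cdot(\phi\cup\{C_1,\dots,C_{i-1}\})$ that has run into a conflict, $C_i\in\mathcal{L}_{\mathcal{T}_i}$,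 $\mathcal{T}_1$ satisfies the natural condition everywhere, and for $i\ge2$ some $(s,t)$ has $\mathcal{T}_i[s,t]=\mathcal{T}_{i-1}[s,t]$ with the natural condition for $\mathcal{T}_i$ at all initial segments extending $\mathcal{T}_i[s,t]$. Size $=\sum_i|\mathcal{T}_i|$. -}

module Defs where

open import Data.Nat using (ℕ; zero; suc; _+_; _*_; _∸_; _≤_; _<_; _≡ᵇ_; _≤ᵇ_)
open import Data.Bool using (Bool; true; false; not; _∧_; _∨_; if_then_else_)
open import Data.List using (List; []; _∷_; _++_; map; filterᵇ; reverse; concatMap; upTo; length; take)
open import Data.Bool.ListAction using (any)
open import Data.Nat.ListAction using (sum)
open import Data.List.Membership.Propositional using (_∈_; _∉_)
open import Data.List.Relation.Unary.Any using (Any)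
open import Data.List.Relation.Unary.Unique.Propositional using (Unique)
open import Data.Product using (Σ; ∃; ∃-syntax; _×_; _,_; proj₁; proj₂)
open import Data.Sum using (_⊎_)
open import Data.Empty using (⊥)
open import Data.Unit using (⊤)
open import Function using (_∘_; _⇔_)
open import Relation.Nullary using (¬_)
open import Relation.Binary.PropositionalEquality using (_≡_)

record Lit : Set where
  constructor lit
  field
    var : ℕ
    pos : Bool      -- true = positive literal x, false = negative literal x̄
open Lit public

neg : Lit → Lit
neg (lit v b) = lit v (not b)

_==B_ : Bool → Bool → Bool
true  ==B b = b
false ==B b = not b

_==L_ : Lit → Lit → Bool
lit v b ==L lit w c = (v ≡ᵇ w) ∧ (b ==B c)

_∈ᵇ_ : Lit → List Lit → Bool
ℓ ∈ᵇ C = any (ℓ ==L_) C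

Clause : Set
Clause = List Lit

CNF : Set
CNF = List Clause

data Quant : Set where
  ∃q ∀q : Quant

Prefix : Set
Prefix = List (Quant × List ℕ)

record QCNF : Set where
  constructor _·_
  field
    prefix : Prefix
    matrix : CNF
open QCNF public

elemℕ : ℕ → List ℕ → Bool
elemℕ x xs = any (x ≡ᵇ_) xs

prefVars : Prefix → List ℕ
prefVars = concatMap proj₂

-- lv: index (starting at 1) of the block containing the variable
-- (0 for variables not in the prefix; never used for closed QCNFs)
lvFrom : ℕ → Prefix → ℕ → ℕ
lvFrom i [] x = 0
lvFrom i ((q , xs) ∷ P) x = if elemℕ x xs then i else lvFrom (suc i) P x

lv : Prefix → ℕ → ℕ
lv = lvFrom 1

isExistQ : Quant → Bool
isExistQ ∃q = true
isExistQ ∀q = false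

isExist : Prefix → ℕ → Bool
isExist [] x = false
isExist ((q , xs) ∷ P) x = if elemℕ x xs then isExistQ q else isExist P x

Existential : Prefix → Lit → Set
Existential P ℓ = isExist P (var ℓ) ≡ true

red : Prefix → Clause → Clause
red P C = filterᵇ keep C
  where
  keep : Lit → Bool
  keep ℓ = isExist P (var ℓ) ∨
           any (λ x → isExist P (var x) ∧ (lv P (var ℓ) ≤ᵇ lv P (var x))) C

resolve : Lit → Clause → Clause → Clause
resolve p C' A = filterᵇ (not ∘ (_==L neg p)) C' ++ filterᵇ (not ∘ (_==L p)) A

Satisfied : Clause → List Lit → Set
Satisfied C σ = Any (_∈ σ) C

RestrictsTo : Clause → List Lit → Lit → Set
RestrictsTo C σ p = ¬ Satisfied C σ × (∀ ℓ → ((ℓ ∈ C × neg ℓ ∉ σ) ⇔ (ℓ ≡ p)))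

RestrictsEmpty : Clause → List Lit → Set
RestrictsEmpty C σ = ¬ Satisfied C σ × (∀ ℓ → ℓ ∈ C → neg ℓ ∈ σ)

UnitUnder : Prefix → Clause → List Lit → Set
UnitUnder P C σ = (∃[ x ] (RestrictsTo C σ x × Existential P x)) ⊎ RestrictsEmpty C σ

data Step : Set where
  dec  : Lit → Step
  prop : Lit → Clause → Step

-- a trail ending in ⊥: its steps (decisions and propagations) followed by ⊥,
-- together with ante(⊥)
record Trail : Set where
  constructor trail
  field
    steps : List Step
    ante⊥ : Clause
open Trail public

data Elem : Set where
  step     : Step → Elem
  conflict : Clause → Elem

elems : Trail → List Elem
elems T = map step (steps T) ++ conflict (ante⊥ T) ∷ []

assign : List Elem → List Lit
assign [] = []
assign (step (dec d) ∷ es) = d ∷ assign es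
assign (step (prop p A) ∷ es) = p ∷ assign es
assign (conflict A ∷ es) = assign es

tlen : Trail → ℕ
tlen T = length (elems T)

data Shape : Set where
  sdec sprop : Lit → Shape
  s⊥ : Shape

shape : Elem → Shape
shape (step (dec d)) = sdec d
shape (step (prop p A)) = sprop p
shape (conflict A) = s⊥

ElemOK : Prefix → CNF → List Lit → Elem → Set
ElemOK P F σ (step (dec d)) =
  var d ∈ prefVars P ×
  -- LEV-ORD
  (∀ x → x ∈ prefVars P → x ∉ map var σ → lv P (var d) ≤ lv P x)
ElemOK P F σ (step (prop p A)) =
  Existential P p × A ∈ F × RestrictsTo A σ p       -- NO-RED
ElemOK P F σ (conflict A) =
  A ∈ F × RestrictsEmpty A σ                         -- NO-RED

ValidTrail : Prefix → CNF → Trail → Set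
ValidTrail P F T =
  Unique (map var (assign (elems T))) ×
  (∀ pre e post → elems T ≡ pre ++ e ∷ post → ElemOK P F (assign pre) e)

Propagates : Prefix → CNF → List Lit → Elem → Set
Propagates P F σ (step (dec d)) = ⊥
Propagates P F σ (step (prop p A)) = A ∈ F × RestrictsTo A σ p × Existential P p
Propagates P F σ (conflict A) = A ∈ F × RestrictsEmpty A σ

IsConflict : Elem → Set
IsConflict (step s) = ⊥
IsConflict (conflict A) = ⊤

NaturalAt : Prefix → CNF → List Lit → Elem → Set
NaturalAt P F σ e =
  ((∃[ C ] (C ∈ F × UnitUnder P C σ)) → Propagates P F σ e) ×
  ((∃[ C ] (C ∈ F × RestrictsEmpty C σ)) → IsConflict e)

NaturalFrom : Prefix → CNF → Trail → ℕ → Set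
NaturalFrom P F T k =
  ∀ pre e post → elems T ≡ pre ++ e ∷ post → k ≤ length pre →
  NaturalAt P F (assign pre) e

learnGo : Prefix → Clause → List Step → List Clause
learnGo P C [] = C ∷ []
learnGo P C (dec d ∷ r) = learnGo P C r
learnGo P C (prop p A ∷ r) =
  C ∷ learnGo P (if neg p ∈ᵇ C then red P (resolve p C (red P A)) else C) r

learnable : Prefix → Trail → List Clause
learnable P T = learnGo P (red P (ante⊥ T)) (reverse (steps T))

learned : List (Trail × Clause) → CNF
learned = map proj₂

-- Tᵢ[s,t] = Tᵢ₋₁[s,t] for some (s,t), with the natural condition for Tᵢ at
-- all initial segments extending Tᵢ[s,t]
Restart : Prefix → CNF → Trail → Trail → Set
Restart P F T Tprev = ∃[ k ]
  (k ≤ tlen T × k ≤ tlen Tprev ×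
   map shape (take k (elems T)) ≡ map shape (take k (elems Tprev)) ×
   NaturalFrom P F T k)

record IsRefutation (Φ : QCNF) (R : List (Trail × Clause)) : Set where
  field
    trails-valid : ∀ pre T C post → R ≡ pre ++ (T , C) ∷ post →
      ValidTrail (prefix Φ) (matrix Φ ++ learned pre) T ×
      C ∈ learnable (prefix Φ) T
    first-natural : ∀ T C post → R ≡ (T , C) ∷ post →
      NaturalFrom (prefix Φ) (matrix Φ) T 0
    restarts : ∀ pre T C T' C' post → R ≡ pre ++ (T , C) ∷ (T' , C') ∷ post →
      Restart (prefix Φ) (matrix Φ ++ learned (pre ++ (T , C) ∷ [])) T' T
    ends-empty : ∃[ pre ] ∃[ T ] (R ≡ pre ++ (T , []) ∷ [])

size : List (Trail × Clause) → ℕ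
size R = sum (map (tlen ∘ proj₁) R)

range1 : ℕ → List ℕ
range1 m = map suc (upTo m)

-- x_{i,j} (i ∈ [n+1], j ∈ [n]) is renamed x_{(i-1)n+j}
phpIdx : ℕ → ℕ → ℕ → ℕ
phpIdx n i j = (i ∸ 1) * n + j

PHP : ℕ → (ℕ → ℕ) → CNF
PHP n x =
  map (λ i → map (λ k → lit (x (phpIdx n i k)) true) (range1 n)) (range1 (suc n)) ++
  concatMap (λ j → concatMap (λ i₁ → concatMap (λ i₂ →
      if i₁ ≤ᵇ i₂ then [] else
      (lit (x (phpIdx n i₁ j)) false ∷ lit (x (phpIdx n i₂ j)) false ∷ []) ∷ [])
    (range1 (suc n))) (range1 (suc n))) (range1 n)

sn : ℕ → ℕ
sn n = n * (n + 1)

module TrapVars (n : ℕ) where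
  s : ℕ
  s = sn n
  yv : ℕ → ℕ
  yv i = i
  wv tv uv : ℕ
  wv = s + 1
  tv = s + 2
  uv = s + s + 3
  xv : ℕ → ℕ
  xv i = s + 2 + i

Trapdoor : ℕ → QCNF
Trapdoor n =
  ((∃q , map yv (range1 s)) ∷ (∀q , wv ∷ []) ∷ (∃q , tv ∷ map xv (range1 s)) ∷
   (∀q , uv ∷ []) ∷ [])
  · (PHP n xv ++ concatMap gadget (range1 s))
  where
  open TrapVars n
  + - : ℕ → Lit
  + v = lit v true
  - v = lit v false
  gadget : ℕ → CNF
  gadget i =
    (- (yv i) ∷ + (xv i) ∷ + uv ∷ []) ∷
    (+ (yv i) ∷ - (xv i) ∷ + uv ∷ []) ∷
    (+ (yv i) ∷ + wv ∷ + tv ∷ []) ∷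
    (+ (yv i) ∷ + wv ∷ - tv ∷ []) ∷
    (- (yv i) ∷ + wv ∷ + tv ∷ []) ∷
    (- (yv i) ∷ + wv ∷ - tv ∷ []) ∷ []

-- Every clause of Trapdoor_n (n ≥ 2) has two distinct literals over variables outside the
-- y-block, one of them beyond w as well. Hence no clause is unit while only y's are
-- assigned, nor falsified once w is assigned too, and a LEV-ORD trail can decide every y
-- false and then w̄ without any propagation. Then the gadget clauses (y₁ ∨ w ∨ t) and
-- (y₁ ∨ w ∨ t̄) propagate t and conflict; resolving them on t leaves y₁ ∨ w ∨ y₁ ∨ w, from
-- which reduction deletes w since its level exceeds that of y₁, so (y₁ ∨ y₁) is learnt.
-- A second trail propagates y₁ from it, decides the other y's and w̄ likewise, conflicts
-- through (ȳ₁ ∨ w ∨ t) and (ȳ₁ ∨ w ∨ t̄) and learns the empty clause. Each trail has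
-- length s_n + 3, so the refutation has size 2(n(n+1) + 3) ≤ 10n². For n = 1 the clauses
-- (x₁), (x₂) and (x̄₂ ∨ x̄₁) of PHP²₁ are refuted by unit propagation alone.

module Submission where

open import Defs
open import Data.Bool using (Bool; true; false; not; T; T?; _∧_; _∨_; if_then_else_)
open import Data.Bool.Properties using (T-≡; T-∧; T-∨; not-¬)
open import Data.Bool.ListAction using (any; all)
open import Data.Empty using (⊥-elim)
open import Data.List using (List; []; _∷_; _++_; map; concatMap; applyUpTo; filterᵇ; reverse; length)
open import Data.List.Properties
  using (++-identityʳ; ++-assoc; filter-all; filter-reject; filter-++; map-∘; map-id; map-++;
         reverse-++; unfold-reverse; reverse-map; length-++; length-map; length-applyUpTo)
open import Data.List.Membership.Propositional using (_∈_; _∉_; find; lose)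
open import Data.List.Membership.Propositional.Properties
  using (∈-map⁻; ∈-map⁺; ∈-++⁻; ∈-++⁺ˡ; ∈-++⁺ʳ; ∈-upTo⁻; ∈-concatMap⁺)
open import Data.List.Relation.Unary.All as All using (All; []; _∷_)
import Data.List.Relation.Unary.All.Properties as All
open import Data.List.Relation.Unary.All.Properties using (All¬⇒¬Any; all⁻)
open import Data.List.Relation.Unary.AllPairs using ([]; _∷_)
open import Data.List.Relation.Unary.Any as Any using (Any; here; there)
open import Data.List.Relation.Unary.Any.Properties using (any⁺; any⁻; concatMap⁻)
open import Data.List.Relation.Unary.Unique.Propositional using (Unique)
import Data.List.Relation.Unary.Unique.Propositional.Properties as UP
open import Data.Nat using (ℕ; suc; pred; _+_; _*_; _^_; _∸_; _≤_; _<_; _≡ᵇ_; _≤ᵇ_; z≤n; s≤s)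
open import Data.Nat.Properties
open import Data.Nat.Tactic.RingSolver using (solve-∀)
open import Data.Product using (∃-syntax; _×_; _,_; proj₁; proj₂)
open import Data.Sum using (_⊎_; inj₁; inj₂)
open import Data.Unit using (⊤; tt)
open import Function using (_∘_; id; Equivalence; mk⇔)
open import Relation.Nullary using (¬_)
open import Relation.Binary.PropositionalEquality
  using (_≡_; _≢_; refl; sym; trans; cong; cong₂; subst; subst₂; module ≡-Reasoning)

≡ᵇ-refl : ∀ m → (m ≡ᵇ m) ≡ true
≡ᵇ-refl m = Equivalence.to T-≡ (≡⇒≡ᵇ m m refl)

∈⇒elemℕ : ∀ {x xs} → x ∈ xs → elemℕ x xs ≡ true
∈⇒elemℕ {x} x∈xs = Equivalence.to T-≡ (any⁺ (x ≡ᵇ_) (Any.map (λ { refl → ≡⇒≡ᵇ x x refl }) x∈xs))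

∉⇒elemℕ : ∀ {x} xs → x ∉ xs → elemℕ x xs ≡ false
∉⇒elemℕ {x} xs x∉xs with elemℕ x xs in eq
... | true  = ⊥-elim (x∉xs (Any.map (≡ᵇ⇒≡ x _) (any⁻ (x ≡ᵇ_) xs (subst T (sym eq) tt))))
... | false = refl

==L-refl : ∀ ℓ → (ℓ ==L ℓ) ≡ true
==L-refl (lit v true)  rewrite ≡ᵇ-refl v = refl
==L-refl (lit v false) rewrite ≡ᵇ-refl v = refl

∈⇒∈ᵇ : ∀ {ℓ C} → ℓ ∈ C → (ℓ ∈ᵇ C) ≡ true
∈⇒∈ᵇ {ℓ} ℓ∈C = Equivalence.to T-≡ (any⁺ (ℓ ==L_) (Any.map (λ { refl → Equivalence.from T-≡ (==L-refl ℓ) }) ℓ∈C))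

==L⇒≡ : ∀ ℓ ℓ′ → T (ℓ ==L ℓ′) → ℓ ≡ ℓ′
==L⇒≡ (lit v true)  (lit w true)  eq = cong (λ u → lit u true) (≡ᵇ⇒≡ v w (proj₁ (Equivalence.to T-∧ eq)))
==L⇒≡ (lit v false) (lit w false) eq = cong (λ u → lit u false) (≡ᵇ⇒≡ v w (proj₁ (Equivalence.to T-∧ eq)))
==L⇒≡ (lit v true)  (lit w false) eq = ⊥-elim (proj₂ (Equivalence.to T-∧ eq))
==L⇒≡ (lit v false) (lit w true)  eq = ⊥-elim (proj₂ (Equivalence.to T-∧ eq))

module _ (i : ℕ) (q : Quant) (xs : List ℕ) (Q : Prefix) {x : ℕ} where

  lvFrom-here : x ∈ xs → lvFrom i ((q , xs) ∷ Q) x ≡ i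
  lvFrom-here x∈xs rewrite ∈⇒elemℕ x∈xs = refl

  lvFrom-there : x ∉ xs → lvFrom i ((q , xs) ∷ Q) x ≡ lvFrom (suc i) Q x
  lvFrom-there x∉xs rewrite ∉⇒elemℕ xs x∉xs = refl

module _ (q : Quant) (xs : List ℕ) (Q : Prefix) {x : ℕ} where

  isExist-here : x ∈ xs → isExist ((q , xs) ∷ Q) x ≡ isExistQ q
  isExist-here x∈xs rewrite ∈⇒elemℕ x∈xs = refl

  isExist-there : x ∉ xs → isExist ((q , xs) ∷ Q) x ≡ isExist Q x
  isExist-there x∉xs rewrite ∉⇒elemℕ xs x∉xs = refl

lvFrom-≥ : ∀ i Q {x} → x ∈ prefVars Q → i ≤ lvFrom i Q x
lvFrom-≥ i ((q , xs) ∷ Q) {x} x∈Q with elemℕ x xs in eq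
... | true  = ≤-refl
... | false with ∈-++⁻ xs x∈Q
...   | inj₁ x∈xs with () ← trans (sym (∈⇒elemℕ x∈xs)) eq
...   | inj₂ x∈Q′ = ≤-trans (n≤1+n i) (lvFrom-≥ (suc i) Q x∈Q′)

module _ {C : Clause} {σ : List Lit} where

  open⇒¬RestrictsEmpty : ∀ {ℓ} → ℓ ∈ C → neg ℓ ∉ σ → ¬ RestrictsEmpty C σ
  open⇒¬RestrictsEmpty ℓ∈C ℓ-open (_ , falsified) = ℓ-open (falsified _ ℓ∈C)

  twoOpen⇒¬RestrictsTo : ∀ {ℓ₁ ℓ₂ p} → ℓ₁ ∈ C → ℓ₂ ∈ C → ℓ₁ ≢ ℓ₂ →
    neg ℓ₁ ∉ σ → neg ℓ₂ ∉ σ → ¬ RestrictsTo C σ p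
  twoOpen⇒¬RestrictsTo ℓ₁∈C ℓ₂∈C ℓ₁≢ℓ₂ ℓ₁-open ℓ₂-open (_ , open⇔p) =
    ℓ₁≢ℓ₂ (trans (Equivalence.to (open⇔p _) (ℓ₁∈C , ℓ₁-open))
            (sym (Equivalence.to (open⇔p _) (ℓ₂∈C , ℓ₂-open))))

  twoOpen⇒¬UnitUnder : ∀ {P ℓ₁ ℓ₂} → ℓ₁ ∈ C → ℓ₂ ∈ C → ℓ₁ ≢ ℓ₂ →
    neg ℓ₁ ∉ σ → neg ℓ₂ ∉ σ → ¬ UnitUnder P C σ
  twoOpen⇒¬UnitUnder ℓ₁∈C ℓ₂∈C ℓ₁≢ℓ₂ ℓ₁-open ℓ₂-open (inj₁ (_ , unit , _)) =
    twoOpen⇒¬RestrictsTo ℓ₁∈C ℓ₂∈C ℓ₁≢ℓ₂ ℓ₁-open ℓ₂-open unit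
  twoOpen⇒¬UnitUnder ℓ₁∈C _ _ ℓ₁-open _ (inj₂ empty) = open⇒¬RestrictsEmpty ℓ₁∈C ℓ₁-open empty

  satisfied⇒¬UnitUnder : ∀ {P} → Satisfied C σ → ¬ UnitUnder P C σ
  satisfied⇒¬UnitUnder sat (inj₁ (_ , (unsat , _) , _)) = unsat sat
  satisfied⇒¬UnitUnder sat (inj₂ (unsat , _))           = unsat sat

  restrictsTo-intro : ∀ {p} → All (_∉ σ) C → p ∈ C → neg p ∉ σ →
    (∀ {ℓ} → ℓ ∈ C → ℓ ≡ p ⊎ neg ℓ ∈ σ) → RestrictsTo C σ p
  restrictsTo-intro unsat p∈C p-open others =
    All¬⇒¬Any unsat , λ ℓ → mk⇔ (to ℓ) λ { refl → p∈C , p-open }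
    where
    to : ∀ ℓ → ℓ ∈ C × neg ℓ ∉ σ → ℓ ≡ _
    to ℓ (ℓ∈C , ℓ-open) with others ℓ∈C
    ... | inj₁ ℓ≡p     = ℓ≡p
    ... | inj₂ ℓ-false = ⊥-elim (ℓ-open ℓ-false)

above⇒∉ : ∀ {b ℓ σ} → All (λ ℓ′ → var ℓ′ ≤ b) σ → b < var ℓ → ℓ ∉ σ
above⇒∉ σ≤b b<ℓ ℓ∈σ = <⇒≱ b<ℓ (All.lookup σ≤b ℓ∈σ)

TwoLate : ℕ → Clause → Set
TwoLate s C = ∃[ ℓ₁ ] ∃[ ℓ₂ ] (ℓ₁ ∈ C × ℓ₂ ∈ C × ℓ₁ ≢ ℓ₂ × s < var ℓ₁ × s + 1 < var ℓ₂)

module _ {s : ℕ} {C : Clause} {σ : List Lit} where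

  twoLate⇒¬UnitUnder : ∀ {P} → TwoLate s C → All (λ ℓ → var ℓ ≤ s) σ → ¬ UnitUnder P C σ
  twoLate⇒¬UnitUnder {P} (_ , _ , ℓ₁∈C , ℓ₂∈C , ℓ₁≢ℓ₂ , s<ℓ₁ , s+1<ℓ₂) σ≤s =
    twoOpen⇒¬UnitUnder {P = P} ℓ₁∈C ℓ₂∈C ℓ₁≢ℓ₂ (above⇒∉ σ≤s s<ℓ₁) (above⇒∉ σ≤s (m+n≤o⇒m≤o (suc s) s+1<ℓ₂))

  twoLate⇒¬RestrictsEmpty : TwoLate s C → All (λ ℓ → var ℓ ≤ s + 1) σ → ¬ RestrictsEmpty C σ
  twoLate⇒¬RestrictsEmpty (_ , _ , _ , ℓ₂∈C , _ , _ , s+1<ℓ₂) σ≤s+1 =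
    open⇒¬RestrictsEmpty ℓ₂∈C (above⇒∉ σ≤s+1 s+1<ℓ₂)

Quiet : Prefix → CNF → List Lit → Set
Quiet P F σ = ∀ {C} → C ∈ F → ¬ UnitUnder P C σ

NoConflict : CNF → List Lit → Set
NoConflict F σ = ∀ {C} → C ∈ F → ¬ RestrictsEmpty C σ

falsified? : List Lit → Clause → Bool
falsified? σ = all (λ ℓ → neg ℓ ∈ᵇ σ)

noConflict-by-evaluation : ∀ {F σ} → any (falsified? σ) F ≡ false → NoConflict F σ
noConflict-by-evaluation {F} {σ} none {C} C∈F (_ , falsified) =
  subst T none (any⁺ (falsified? σ) (lose C∈F (all⁻ _ (All.tabulate (∈⇒T∈ᵇ ∘ falsified _)))))
  where
  ∈⇒T∈ᵇ : ∀ {ℓ C} → ℓ ∈ C → T (ℓ ∈ᵇ C)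
  ∈⇒T∈ᵇ = Equivalence.from T-≡ ∘ ∈⇒∈ᵇ

-- red P C filters C by kept P C.
kept : Prefix → Clause → Lit → Bool
kept P C ℓ = isExist P (var ℓ) ∨ any (λ x → isExist P (var x) ∧ (lv P (var ℓ) ≤ᵇ lv P (var x))) C

module _ {P : Prefix} {C : Clause} where

  kept-existential : ∀ {ℓ} → Existential P ℓ → T (kept P C ℓ)
  kept-existential ℓ-∃ = Equivalence.from T-∨ (inj₁ (Equivalence.from T-≡ ℓ-∃))

  kept-dominated : ∀ {ℓ x} → x ∈ C → Existential P x → lv P (var ℓ) ≤ lv P (var x) →
    T (kept P C ℓ)
  kept-dominated x∈C x-∃ ℓ≤x = Equivalence.from T-∨ (inj₂ (any⁺ _ (lose x∈C
    (Equivalence.from T-∧ (Equivalence.from T-≡ x-∃ , ≤⇒≤ᵇ ℓ≤x)))))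

  ¬kept : ∀ {ℓ} → isExist P (var ℓ) ≡ false →
    (∀ {x} → x ∈ C → Existential P x → lv P (var x) < lv P (var ℓ)) → ¬ T (kept P C ℓ)
  ¬kept {ℓ} ℓ-∀ below kept-ℓ with Equivalence.to T-∨ kept-ℓ
  ... | inj₁ ℓ-∃ = subst T ℓ-∀ ℓ-∃
  ... | inj₂ dominated
    with x , x∈C , x-∃∧ℓ≤x ← find (any⁻ _ C dominated)
    with x-∃ , ℓ≤ᵇx ← Equivalence.to T-∧ x-∃∧ℓ≤x =
    <⇒≱ (below x∈C (Equivalence.to T-≡ x-∃)) (≤ᵇ⇒≤ _ _ ℓ≤ᵇx)

  red-kept : All (T ∘ kept P C) C → red P C ≡ C
  red-kept = filter-all (T? ∘ kept P C)

removing : Lit → Lit → Bool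
removing ℓ = not ∘ (_==L ℓ)

removing-absent : ∀ {ℓ} C → ℓ ∉ C → filterᵇ (removing ℓ) C ≡ C
removing-absent {ℓ} C ℓ∉C = filter-all (T? ∘ removing ℓ) (All.tabulate keep)
  where
  keep : ∀ {ℓ′} → ℓ′ ∈ C → T (not (ℓ′ ==L ℓ))
  keep {ℓ′} ℓ′∈C with ℓ′ ==L ℓ in eq
  ... | true  = ℓ∉C (subst (_∈ C) (==L⇒≡ ℓ′ ℓ (subst T (sym eq) tt)) ℓ′∈C)
  ... | false = tt

removing-last : ∀ ℓ C → ℓ ∉ C → filterᵇ (removing ℓ) (C ++ ℓ ∷ []) ≡ C
removing-last ℓ C ℓ∉C = begin
  filterᵇ (removing ℓ) (C ++ ℓ ∷ [])                        ≡⟨ filter-++ (T? ∘ removing ℓ) C (ℓ ∷ []) ⟩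
  filterᵇ (removing ℓ) C ++ filterᵇ (removing ℓ) (ℓ ∷ [])   ≡⟨ cong₂ _++_ (removing-absent C ℓ∉C) removes-ℓ ⟩
  C ++ []                                                   ≡⟨ ++-identityʳ C ⟩
  C                                                         ∎
  where
  open ≡-Reasoning
  removes-ℓ : filterᵇ (removing ℓ) (ℓ ∷ []) ≡ []
  removes-ℓ = filter-reject (T? ∘ removing ℓ) {x = ℓ} {xs = []} (subst (T ∘ not) (==L-refl ℓ))

resolve-last : ∀ p C A → neg p ∉ C → p ∉ A →
  resolve p (C ++ neg p ∷ []) (A ++ p ∷ []) ≡ C ++ A
resolve-last p C A p̄∉C p∉A = cong₂ _++_ (removing-last (neg p) C p̄∉C) (removing-last p A p∉A)

learnGo-decisions : ∀ P C (f : ℕ → Lit) L rest → learnGo P C (map (dec ∘ f) L ++ rest) ≡ learnGo P C rest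
learnGo-decisions P C f []      rest = refl
learnGo-decisions P C f (_ ∷ L) rest = learnGo-decisions P C f L rest

Stepwise : (List Lit → Elem → Set) → List Lit → List Elem → Set
Stepwise Q σ []       = ⊤
Stepwise Q σ (e ∷ es) = Q σ e × Stepwise Q (σ ++ assign (e ∷ [])) es

assign-++ : ∀ xs ys → assign (xs ++ ys) ≡ assign xs ++ assign ys
assign-++ []                      ys = refl
assign-++ (step (dec d) ∷ xs)     ys = cong (d ∷_) (assign-++ xs ys)
assign-++ (step (prop p _) ∷ xs)  ys = cong (p ∷_) (assign-++ xs ys)
assign-++ (conflict _ ∷ xs)       ys = assign-++ xs ys

assign-decisions : ∀ (f : ℕ → Lit) L → assign (map step (map (dec ∘ f) L)) ≡ map f L
assign-decisions f []      = refl
assign-decisions f (v ∷ L) = cong (f v ∷_) (assign-decisions f L)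

module _ {Q : List Lit → Elem → Set} where

  stepwise-at : ∀ {σ} es → Stepwise Q σ es → ∀ pre e post → es ≡ pre ++ e ∷ post →
    Q (σ ++ assign pre) e
  stepwise-at {σ} _ (q , _) [] e post refl = subst (λ τ → Q τ e) (sym (++-identityʳ σ)) q
  stepwise-at {σ} _ (_ , qs) (e′ ∷ pre) e post refl =
    subst (λ τ → Q τ e) assoc (stepwise-at _ qs pre e post refl)
    where
    assoc : (σ ++ assign (e′ ∷ [])) ++ assign pre ≡ σ ++ assign (e′ ∷ pre)
    assoc = trans (++-assoc σ _ _) (cong (σ ++_) (sym (assign-++ (e′ ∷ []) pre)))

  stepwise-decisions : ∀ (Inv : List Lit → Set) (f : ℕ → Lit) L {σ} rest →
    (∀ {τ v} → v ∈ L → Inv τ → Q τ (step (dec (f v)))) →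
    (∀ {τ v} → v ∈ L → Inv τ → Inv (τ ++ f v ∷ [])) →
    Inv σ → Stepwise Q (σ ++ map f L) rest →
    Stepwise Q σ (map step (map (dec ∘ f) L) ++ rest)
  stepwise-decisions Inv f [] {σ} rest _ _ _ qs = subst (λ τ → Stepwise Q τ rest) (++-identityʳ σ) qs
  stepwise-decisions Inv f (v ∷ L) {σ} rest q-dec inv-dec inv qs =
    q-dec (here refl) inv ,
    stepwise-decisions Inv f L rest (q-dec ∘ there) (inv-dec ∘ there) (inv-dec (here refl) inv)
      (subst (λ τ → Stepwise Q τ rest) (sym (++-assoc σ (f v ∷ []) (map f L))) qs)

CheckedAt : Prefix → CNF → List Lit → Elem → Set
CheckedAt P F σ e = ElemOK P F σ e × NaturalAt P F σ e

NaturalTrail : Prefix → CNF → Trail → Set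
NaturalTrail P F T =
  Unique (map var (assign (elems T))) × Stepwise (CheckedAt P F) [] (elems T)

module _ {P : Prefix} {F : CNF} {T : Trail} (natural : NaturalTrail P F T) where

  naturalTrail⇒valid : ValidTrail P F T
  naturalTrail⇒valid = proj₁ natural ,
    λ pre e post eq → proj₁ (stepwise-at (elems T) (proj₂ natural) pre e post eq)

  naturalTrail⇒naturalFrom : ∀ k → NaturalFrom P F T k
  naturalTrail⇒naturalFrom _ pre e post eq _ =
    proj₂ (stepwise-at (elems T) (proj₂ natural) pre e post eq)

module _ {P : Prefix} {F : CNF} {σ : List Lit} where

  checkedAt-dec : ∀ {d} → var d ∈ prefVars P →
    (∀ x → x ∈ prefVars P → x ∉ map var σ → lv P (var d) ≤ lv P x) →
    Quiet P F σ → CheckedAt P F σ (step (dec d))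
  checkedAt-dec d∈P lev-ord quiet =
    (d∈P , lev-ord) ,
    (λ (_ , C∈F , unit) → quiet C∈F unit) , (λ (_ , C∈F , empty) → quiet C∈F (inj₂ empty))

  checkedAt-prop : ∀ {p A} → Existential P p → A ∈ F → RestrictsTo A σ p →
    NoConflict F σ → CheckedAt P F σ (step (prop p A))
  checkedAt-prop p-∃ A∈F A↦p no-conflict =
    (p-∃ , A∈F , A↦p) , (λ _ → A∈F , A↦p , p-∃) , (λ (_ , C∈F , empty) → no-conflict C∈F empty)

  checkedAt-conflict : ∀ {A} → A ∈ F → RestrictsEmpty A σ → CheckedAt P F σ (conflict A)
  checkedAt-conflict A∈F A↦⊥ = (A∈F , A↦⊥) , (λ _ → A∈F , A↦⊥) , (λ _ → tt)

module _ {P : Prefix} {F : CNF} where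

  refutation₁ : ∀ {T} → NaturalTrail P F T → [] ∈ learnable P T →
    IsRefutation (P · F) ((T , []) ∷ [])
  refutation₁ {T} natural learn = record
    { trails-valid  = valid
    ; first-natural = λ { _ _ _ refl → naturalTrail⇒naturalFrom natural 0 }
    ; restarts      = λ { [] _ _ _ _ _ () ; (_ ∷ []) _ _ _ _ _ () ; (_ ∷ _ ∷ _) _ _ _ _ _ () }
    ; ends-empty    = [] , T , refl
    }
    where
    valid : ∀ pre T′ C post → (T , []) ∷ [] ≡ pre ++ (T′ , C) ∷ post →
      ValidTrail P (F ++ learned pre) T′ × C ∈ learnable P T′
    valid [] _ _ _ refl =
      subst (λ G → ValidTrail P G T) (sym (++-identityʳ F)) (naturalTrail⇒valid natural) , learn
    valid (_ ∷ []) _ _ _ ()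
    valid (_ ∷ _ ∷ _) _ _ _ ()

  refutation₂ : ∀ {T₁ C T₂} → NaturalTrail P F T₁ → C ∈ learnable P T₁ →
    NaturalTrail P (F ++ C ∷ []) T₂ → [] ∈ learnable P T₂ →
    IsRefutation (P · F) ((T₁ , C) ∷ (T₂ , []) ∷ [])
  refutation₂ {T₁} {C} {T₂} natural₁ learn₁ natural₂ learn₂ = record
    { trails-valid  = valid
    ; first-natural = λ { _ _ _ refl → naturalTrail⇒naturalFrom natural₁ 0 }
    ; restarts      = restart
    ; ends-empty    = (T₁ , C) ∷ [] , T₂ , refl
    }
    where
    valid : ∀ pre T C′ post → (T₁ , C) ∷ (T₂ , []) ∷ [] ≡ pre ++ (T , C′) ∷ post →
      ValidTrail P (F ++ learned pre) T × C′ ∈ learnable P T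
    valid [] _ _ _ refl =
      subst (λ G → ValidTrail P G T₁) (sym (++-identityʳ F)) (naturalTrail⇒valid natural₁) , learn₁
    valid (_ ∷ []) _ _ _ refl = naturalTrail⇒valid natural₂ , learn₂
    valid (_ ∷ _ ∷ []) _ _ _ ()
    valid (_ ∷ _ ∷ _ ∷ _) _ _ _ ()
    restart : ∀ pre T C′ T′ C″ post → (T₁ , C) ∷ (T₂ , []) ∷ [] ≡ pre ++ (T , C′) ∷ (T′ , C″) ∷ post →
      Restart P (F ++ learned (pre ++ (T , C′) ∷ [])) T′ T
    restart [] _ _ _ _ _ refl = 0 , z≤n , z≤n , refl , naturalTrail⇒naturalFrom natural₂ 0
    restart (_ ∷ []) _ _ _ _ _ ()
    restart (_ ∷ _ ∷ []) _ _ _ _ _ ()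
    restart (_ ∷ _ ∷ _ ∷ _) _ _ _ _ _ ()

range1⁻ : ∀ {m v} → v ∈ range1 m → 1 ≤ v × v ≤ m
range1⁻ v∈ with _ , u∈ , refl ← ∈-map⁻ suc v∈ = s≤s z≤n , ∈-upTo⁻ u∈

phpPigeonClause : ℕ → (ℕ → ℕ) → ℕ → Clause
phpPigeonClause n x i = map (λ j → lit (x (phpIdx n i j)) true) (range1 n)

phpHoleClauses : ℕ → (ℕ → ℕ) → ℕ → ℕ → ℕ → CNF
phpHoleClauses n x j i₁ i₂ = if i₁ ≤ᵇ i₂ then [] else
  (lit (x (phpIdx n i₁ j)) false ∷ lit (x (phpIdx n i₂ j)) false ∷ []) ∷ []

data PHPClause (n : ℕ) (x : ℕ → ℕ) : Clause → Set where
  pigeon : ∀ i → PHPClause n x (phpPigeonClause n x i)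
  hole   : ∀ j i₁ i₂ → 1 ≤ i₂ → i₂ < i₁ →
    PHPClause n x (lit (x (phpIdx n i₁ j)) false ∷ lit (x (phpIdx n i₂ j)) false ∷ [])

∈-concatMap⁻′ : ∀ {A B : Set} {f : A → List B} {xs y} → y ∈ concatMap f xs → ∃[ x ] (x ∈ xs × y ∈ f x)
∈-concatMap⁻′ = find ∘ concatMap⁻ _

php-clause : ∀ n x {C} → C ∈ PHP n x → PHPClause n x C
php-clause n x C∈ with ∈-++⁻ (map (phpPigeonClause n x) (range1 (suc n))) C∈
... | inj₁ C∈pigeons with i , _ , refl ← ∈-map⁻ (phpPigeonClause n x) {xs = range1 (suc n)} C∈pigeons = pigeon i
... | inj₂ C∈holes
  with j , _ , C∈j ← ∈-concatMap⁻′
         {f = λ j → concatMap (λ i₁ → concatMap (phpHoleClauses n x j i₁) (range1 (suc n))) (range1 (suc n))}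
         {xs = range1 n} C∈holes
  with i₁ , _ , C∈i₁ ← ∈-concatMap⁻′
         {f = λ i₁ → concatMap (phpHoleClauses n x j i₁) (range1 (suc n))} {xs = range1 (suc n)} C∈j
  with i₂ , i₂∈ , C∈i₂ ← ∈-concatMap⁻′ {f = phpHoleClauses n x j i₁} {xs = range1 (suc n)} C∈i₁
  with i₁ ≤ᵇ i₂ in i₁≤ᵇi₂
... | false with here refl ← C∈i₂ =
  hole j i₁ i₂ (proj₁ (range1⁻ i₂∈)) (≰⇒> λ i₁≤i₂ → subst T i₁≤ᵇi₂ (≤⇒≤ᵇ i₁≤i₂))

TwoVarsOver : (ℕ → ℕ) → Clause → Set
TwoVarsOver x C = ∃[ a ] ∃[ b ] ∃[ p ] ∃[ q ] (a ≢ b × lit (x a) p ∈ C × lit (x b) q ∈ C)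

php-twoVarsOver : ∀ k x {C} → C ∈ PHP (2 + k) x → TwoVarsOver x C
php-twoVarsOver k x C∈ with php-clause (2 + k) x C∈
... | pigeon i = _ , _ , _ , _ , 1≢2 ∘ +-cancelˡ-≡ ((i ∸ 1) * (2 + k)) 1 2 , here refl , there (here refl)
  where
  1≢2 : 1 ≢ 2
  1≢2 ()
... | hole j i₁ i₂ 1≤i₂ i₂<i₁ = _ , _ , _ , _ , (<⇒≢ idx< ∘ sym) , here refl , there (here refl)
  where
  idx< : phpIdx (2 + k) i₂ j < phpIdx (2 + k) i₁ j
  idx< = +-monoˡ-< j (*-monoˡ-< (2 + k) (∸-monoˡ-< i₂<i₁ 1≤i₂))

module TrapdoorMatrix (n : ℕ) where
  open TrapVars n

  s<w : s < wv
  s<w = m<m+n s (s≤s z≤n)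

  w<t : wv < tv
  w<t = +-monoʳ-< s (n<1+n 1)

  w<x : ∀ i → wv < xv i
  w<x i = <-≤-trans w<t (m≤m+n tv i)

  s<u : s < uv
  s<u = <-≤-trans (m<m+n s {3} (s≤s z≤n)) (+-monoˡ-≤ 3 (m≤m+n s s))

  x<u : ∀ {i} → i ≤ s → xv i < uv
  x<u {i} i≤s = begin-strict
    s + 2 + i   ≡⟨ +-assoc s 2 i ⟩
    s + (2 + i) <⟨ +-monoʳ-< s (s≤s (s≤s (s≤s i≤s))) ⟩
    s + (3 + s) ≡⟨ cong (s +_) (+-comm 3 s) ⟩
    s + (s + 3) ≡⟨ +-assoc s s 3 ⟨
    s + s + 3   ∎
    where open ≤-Reasoning

  twoVarsOver⇒twoLate : ∀ {C} → TwoVarsOver xv C → TwoLate s C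
  twoVarsOver⇒twoLate (a , b , _ , _ , a≢b , a∈C , b∈C) =
    _ , _ , a∈C , b∈C , a≢b ∘ +-cancelˡ-≡ tv a b ∘ cong var , <-trans s<w (w<x a) , w<x b

  x-u-twoLate : ∀ {y i p} → i ≤ s → TwoLate s (y ∷ lit (xv i) p ∷ lit uv true ∷ [])
  x-u-twoLate {i = i} i≤s =
    _ , _ , there (there (here refl)) , there (here refl) , <⇒≢ (x<u i≤s) ∘ sym ∘ cong var , s<u , w<x i

  w-t-twoLate : ∀ {y b} → TwoLate s (y ∷ lit wv true ∷ lit tv b ∷ [])
  w-t-twoLate = _ , _ , there (here refl) , there (there (here refl)) , <⇒≢ w<t ∘ cong var , s<w , w<t

  -- Definitionally the gadget local to Trapdoor.
  gadget : ℕ → CNF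
  gadget i =
    (lit (yv i) false ∷ lit (xv i) true  ∷ lit uv true ∷ []) ∷
    (lit (yv i) true  ∷ lit (xv i) false ∷ lit uv true ∷ []) ∷
    (lit (yv i) true  ∷ lit wv true ∷ lit tv true  ∷ []) ∷
    (lit (yv i) true  ∷ lit wv true ∷ lit tv false ∷ []) ∷
    (lit (yv i) false ∷ lit wv true ∷ lit tv true  ∷ []) ∷
    (lit (yv i) false ∷ lit wv true ∷ lit tv false ∷ []) ∷ []

  php⊎twoLate : ∀ {C} → C ∈ matrix (Trapdoor n) → C ∈ PHP n xv ⊎ TwoLate s C
  php⊎twoLate C∈ with ∈-++⁻ (PHP n xv) C∈
  ... | inj₁ C∈php = inj₁ C∈php
  ... | inj₂ C∈gadgets with i , i∈ , C∈gadget ← ∈-concatMap⁻′ {f = gadget} {xs = range1 s} C∈gadgets with C∈gadget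
  ... | here refl                                       = inj₂ (x-u-twoLate (proj₂ (range1⁻ i∈)))
  ... | there (here refl)                               = inj₂ (x-u-twoLate (proj₂ (range1⁻ i∈)))
  ... | there (there (here refl))                       = inj₂ w-t-twoLate
  ... | there (there (there (here refl)))               = inj₂ w-t-twoLate
  ... | there (there (there (there (here refl))))       = inj₂ w-t-twoLate
  ... | there (there (there (there (there (here refl))))) = inj₂ w-t-twoLate

module TrapdoorRefutation≥2 (k : ℕ) where
  open TrapVars (2 + k)
  open TrapdoorMatrix (2 + k)

  P : Prefix
  P = prefix (Trapdoor (2 + k))

  M : CNF
  M = matrix (Trapdoor (2 + k))

  matrix-twoLate : ∀ {C} → C ∈ M → TwoLate s C
  matrix-twoLate C∈M with php⊎twoLate C∈M
  ... | inj₁ C∈php = twoVarsOver⇒twoLate (php-twoVarsOver k xv C∈php)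
  ... | inj₂ late  = late

  Ys : List ℕ
  Ys = map yv (range1 s)

  -- s is a successor, so range1 s reduces to 1 ∷ laterYs.
  laterYs : List ℕ
  laterYs = map suc (applyUpTo suc (pred s))

  range1-unique : Unique (range1 s)
  range1-unique = UP.map⁺ suc-injective (UP.upTo⁺ s)

  1∉laterYs : 1 ∉ laterYs
  1∉laterYs with 1≢laterYs ∷ _ ← range1-unique = All¬⇒¬Any 1≢laterYs

  1≤s : 1 ≤ s
  1≤s = s≤s z≤n

  Ys⊆range1 : ∀ {v} → v ∈ Ys → v ∈ range1 s
  Ys⊆range1 v∈Ys with _ , u∈ , refl ← ∈-map⁻ yv v∈Ys = u∈

  Ys⇒≤s : ∀ {v} → v ∈ Ys → v ≤ s
  Ys⇒≤s = proj₂ ∘ range1⁻ ∘ Ys⊆range1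

  above-Ys : ∀ {v} → s < v → v ∉ Ys
  above-Ys s<v = <⇒≱ s<v ∘ Ys⇒≤s

  t∉[w] : tv ∉ wv ∷ []
  t∉[w] (here t≡w) = <⇒≢ w<t (sym t≡w)

  Ts : List ℕ
  Ts = tv ∷ map xv (range1 s)

  after-w after-y : Prefix
  after-w = (∃q , Ts) ∷ (∀q , uv ∷ []) ∷ []
  after-y = (∀q , wv ∷ []) ∷ after-w

  y∈P : ∀ {v} → v ∈ range1 s → v ∈ prefVars P
  y∈P = ∈-++⁺ˡ {ys = prefVars after-y} ∘ ∈-map⁺ yv

  w∈P : wv ∈ prefVars P
  w∈P = ∈-++⁺ʳ Ys {ys = prefVars after-y} (here refl)

  lv-y : ∀ {v} → v ∈ range1 s → lv P v ≡ 1
  lv-y = lvFrom-here 1 ∃q Ys after-y ∘ ∈-map⁺ yv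

  lv-w : lv P wv ≡ 2
  lv-w = trans (lvFrom-there 1 ∃q Ys after-y (above-Ys s<w))
               (lvFrom-here 2 ∀q (wv ∷ []) after-w (here refl))

  lv-t : lv P tv ≡ 3
  lv-t = trans (lvFrom-there 1 ∃q Ys after-y (above-Ys (<-trans s<w w<t)))
        (trans (lvFrom-there 2 ∀q (wv ∷ []) after-w t∉[w])
               (lvFrom-here 3 ∃q Ts ((∀q , uv ∷ []) ∷ []) (here refl)))

  isExist-w : isExist P wv ≡ false
  isExist-w = trans (isExist-there ∃q Ys after-y (above-Ys s<w))
                    (isExist-here ∀q (wv ∷ []) after-w (here refl))

  isExist-t : isExist P tv ≡ true
  isExist-t = trans (isExist-there ∃q Ys after-y (above-Ys (<-trans s<w w<t)))
             (trans (isExist-there ∀q (wv ∷ []) after-w t∉[w])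
                    (isExist-here ∃q Ts ((∀q , uv ∷ []) ∷ []) (here refl)))

  lv-beyond-Ys : ∀ {x} → x ∈ prefVars P → x ∉ Ys → 2 ≤ lv P x
  lv-beyond-Ys x∈P x∉Ys with ∈-++⁻ Ys x∈P
  ... | inj₁ x∈Ys   = ⊥-elim (x∉Ys x∈Ys)
  ... | inj₂ x∈rest = subst (2 ≤_) (sym (lvFrom-there 1 ∃q Ys after-y x∉Ys)) (lvFrom-≥ 2 after-y x∈rest)

  ȳ : ℕ → Lit
  ȳ v = lit v false

  w̄ t⁺ : Lit
  w̄  = lit wv false
  t⁺ = lit tv true

  yw : Bool → Clause
  yw b = lit 1 b ∷ lit wv true ∷ []

  tClause : Bool → Bool → Clause
  tClause b c = yw b ++ lit tv c ∷ []

  tClause∈M : ∀ b c → tClause b c ∈ M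
  tClause∈M b c = ∈-++⁺ʳ (PHP (2 + k) xv) (∈-concatMap⁺ gadget {xs = range1 s} (here (in-gadget b c)))
    where
    in-gadget : ∀ b c → tClause b c ∈ gadget 1
    in-gadget true  true  = there (there (here refl))
    in-gadget true  false = there (there (there (here refl)))
    in-gadget false true  = there (there (there (there (here refl))))
    in-gadget false false = there (there (there (there (there (here refl)))))

  σy σw σ⊥ : Bool → List Lit
  σy b = lit 1 (not b) ∷ map ȳ laterYs
  σw b = σy b ++ w̄ ∷ []
  σ⊥ b = σw b ++ t⁺ ∷ []

  vars-σy : ∀ b → map var (σy b) ≡ range1 s
  vars-σy b = cong (1 ∷_) (trans (sym (map-∘ laterYs)) (map-id laterYs))

  σy-≤s : ∀ b → All (λ ℓ → var ℓ ≤ s) (σy b)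
  σy-≤s b = All.map⁻ (subst (All (_≤ s)) (sym (vars-σy b)) (All.tabulate (proj₂ ∘ range1⁻)))

  σw-≤s+1 : ∀ b → All (λ ℓ → var ℓ ≤ s + 1) (σw b)
  σw-≤s+1 b = All.++⁺ (All.map (λ ℓ≤s → ≤-trans ℓ≤s (m≤m+n s 1)) (σy-≤s b)) (≤-refl ∷ [])

  σ⊥-cases : ∀ {b ℓ} → ℓ ∈ σ⊥ b → ℓ ∈ σy b ⊎ ℓ ≡ w̄ ⊎ ℓ ≡ t⁺
  σ⊥-cases {b} ℓ∈ with ∈-++⁻ (σw b) ℓ∈
  ... | inj₂ (here ℓ≡t) = inj₂ (inj₂ ℓ≡t)
  ... | inj₁ ℓ∈σw with ∈-++⁻ (σy b) ℓ∈σw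
  ...   | inj₁ ℓ∈σy        = inj₁ ℓ∈σy
  ...   | inj₂ (here ℓ≡w)  = inj₂ (inj₁ ℓ≡w)

  y∉σ⊥ : ∀ b → lit 1 b ∉ σ⊥ b
  y∉σ⊥ b y∈ with σ⊥-cases y∈
  ... | inj₁ (here y≡ȳ)      = not-¬ refl (cong pos y≡ȳ)
  ... | inj₁ (there y∈later) with v , v∈ , y≡ȳv ← ∈-map⁻ ȳ y∈later =
    1∉laterYs (subst (_∈ laterYs) (sym (cong var y≡ȳv)) v∈)
  ... | inj₂ (inj₁ y≡w)      = <⇒≢ (≤-<-trans 1≤s s<w) (cong var y≡w)
  ... | inj₂ (inj₂ y≡t)      = <⇒≢ (≤-<-trans 1≤s (<-trans s<w w<t)) (cong var y≡t)

  w∉σ⊥ : ∀ b → lit wv true ∉ σ⊥ b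
  w∉σ⊥ b w∈ with σ⊥-cases w∈
  ... | inj₁ w∈σy        = above⇒∉ (σy-≤s b) s<w w∈σy
  ... | inj₂ (inj₁ ())
  ... | inj₂ (inj₂ w≡t)  = <⇒≢ w<t (cong var w≡t)

  t̄∉σ⊥ : ∀ b → lit tv false ∉ σ⊥ b
  t̄∉σ⊥ b t̄∈ with σ⊥-cases t̄∈
  ... | inj₁ t̄∈σy        = above⇒∉ (σy-≤s b) (<-trans s<w w<t) t̄∈σy
  ... | inj₂ (inj₁ t̄≡w)  = <⇒≢ w<t (sym (cong var t̄≡w))
  ... | inj₂ (inj₂ ())

  σw⊆σ⊥ : ∀ {b ℓ} → ℓ ∈ σw b → ℓ ∈ σ⊥ b
  σw⊆σ⊥ = ∈-++⁺ˡ

  t-unit : ∀ b → RestrictsTo (tClause b true) (σw b) t⁺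
  t-unit b = restrictsTo-intro
    (y∉σ⊥ b ∘ σw⊆σ⊥ ∷ w∉σ⊥ b ∘ σw⊆σ⊥ ∷ above⇒∉ (σw-≤s+1 b) (+-monoʳ-< s ≤-refl) ∷ [])
    (there (there (here refl))) (t̄∉σ⊥ b ∘ σw⊆σ⊥) others
    where
    others : ∀ {ℓ} → ℓ ∈ tClause b true → ℓ ≡ t⁺ ⊎ neg ℓ ∈ σw b
    others (here refl)                 = inj₂ (here refl)
    others (there (here refl))         = inj₂ (∈-++⁺ʳ (σy b) (here refl))
    others (there (there (here refl))) = inj₁ refl

  t̄-conflict : ∀ b → RestrictsEmpty (tClause b false) (σ⊥ b)
  t̄-conflict b = All¬⇒¬Any (y∉σ⊥ b ∷ w∉σ⊥ b ∷ t̄∉σ⊥ b ∷ []) , falsified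
    where
    falsified : ∀ ℓ → ℓ ∈ tClause b false → neg ℓ ∈ σ⊥ b
    falsified _ (here refl)                 = here refl
    falsified _ (there (here refl))         = σw⊆σ⊥ (∈-++⁺ʳ (σy b) (here refl))
    falsified _ (there (there (here refl))) = ∈-++⁺ʳ (σw b) (here refl)

  Tame : Bool → CNF → Set
  Tame b F = ∀ {C} → C ∈ F → TwoLate s C ⊎ lit 1 (not b) ∈ C

  module _ {b : Bool} {F : CNF} (tame : Tame b F) {τ : List Lit} (y∈τ : lit 1 (not b) ∈ τ) where

    tame-quiet : All (λ ℓ → var ℓ ≤ s) τ → Quiet P F τ
    tame-quiet τ≤s C∈F with tame C∈F
    ... | inj₁ late = twoLate⇒¬UnitUnder {P = P} late τ≤s
    ... | inj₂ y∈C  = satisfied⇒¬UnitUnder {P = P} (lose y∈C y∈τ)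

    tame-noConflict : All (λ ℓ → var ℓ ≤ s + 1) τ → NoConflict F τ
    tame-noConflict τ≤s+1 C∈F with tame C∈F
    ... | inj₁ late = twoLate⇒¬RestrictsEmpty late τ≤s+1
    ... | inj₂ y∈C  = λ empty → proj₁ empty (lose y∈C y∈τ)

  ending : Bool → List Elem
  ending b = step (dec w̄) ∷ step (prop t⁺ (tClause b true)) ∷ conflict (tClause b false) ∷ []

  trapTrail : Step → Bool → Trail
  trapTrail first b =
    trail (first ∷ map (dec ∘ ȳ) laterYs ++ dec w̄ ∷ prop t⁺ (tClause b true) ∷ []) (tClause b false)

  elems-trapTrail : ∀ first b →
    elems (trapTrail first b) ≡ step first ∷ map step (map (dec ∘ ȳ) laterYs) ++ ending b
  elems-trapTrail first b = cong (step first ∷_) (begin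
    map step (D ++ E) ++ ⊥ ∷ []          ≡⟨ cong (_++ ⊥ ∷ []) (map-++ step D E) ⟩
    (map step D ++ map step E) ++ ⊥ ∷ [] ≡⟨ ++-assoc (map step D) (map step E) (⊥ ∷ []) ⟩
    map step D ++ ending b               ∎)
    where
    open ≡-Reasoning
    D = map (dec ∘ ȳ) laterYs
    E = dec w̄ ∷ prop t⁺ (tClause b true) ∷ []
    ⊥ = conflict (tClause b false)

  assign-trapTrail : ∀ first b → assign (step first ∷ []) ≡ lit 1 (not b) ∷ [] →
    assign (elems (trapTrail first b)) ≡ σy b ++ w̄ ∷ t⁺ ∷ []
  assign-trapTrail first b first-assigns = begin
    assign (elems (trapTrail first b))                     ≡⟨ cong assign (elems-trapTrail first b) ⟩
    assign (step first ∷ map step D ++ ending b)           ≡⟨ assign-++ (step first ∷ []) _ ⟩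
    assign (step first ∷ []) ++ assign (map step D ++ ending b)
      ≡⟨ cong₂ _++_ first-assigns (assign-++ (map step D) (ending b)) ⟩
    lit 1 (not b) ∷ assign (map step D) ++ w̄ ∷ t⁺ ∷ []
      ≡⟨ cong (λ L → lit 1 (not b) ∷ L ++ w̄ ∷ t⁺ ∷ []) (assign-decisions ȳ laterYs) ⟩
    σy b ++ w̄ ∷ t⁺ ∷ []                                   ∎
    where
    open ≡-Reasoning
    D = map (dec ∘ ȳ) laterYs

  unique-trapTrail : ∀ first b → assign (step first ∷ []) ≡ lit 1 (not b) ∷ [] →
    Unique (map var (assign (elems (trapTrail first b))))
  unique-trapTrail first b first-assigns = subst Unique (sym vars)
    (UP.++⁺ range1-unique ((<⇒≢ w<t ∷ []) ∷ [] ∷ []) disjoint)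
    where
    vars : map var (assign (elems (trapTrail first b))) ≡ range1 s ++ wv ∷ tv ∷ []
    vars = trans (cong (map var) (assign-trapTrail first b first-assigns))
                 (trans (map-++ var (σy b) (w̄ ∷ t⁺ ∷ [])) (cong (_++ wv ∷ tv ∷ []) (vars-σy b)))
    disjoint : ∀ {v} → ¬ (v ∈ range1 s × v ∈ wv ∷ tv ∷ [])
    disjoint (v∈ , here refl)         = <⇒≱ s<w (proj₂ (range1⁻ v∈))
    disjoint (v∈ , there (here refl)) = <⇒≱ (<-trans s<w w<t) (proj₂ (range1⁻ v∈))

  trapTrail-natural : ∀ {b F} first → Tame b F → (∀ {C} → C ∈ M → C ∈ F) →
    assign (step first ∷ []) ≡ lit 1 (not b) ∷ [] → CheckedAt P F [] (step first) →
    NaturalTrail P F (trapTrail first b)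
  trapTrail-natural {b} {F} first tame M⊆F first-assigns first-checked =
    unique-trapTrail first b first-assigns ,
    subst (Stepwise (CheckedAt P F) []) (sym (elems-trapTrail first b))
      (first-checked ,
       subst (λ τ → Stepwise (CheckedAt P F) τ (map step (map (dec ∘ ȳ) laterYs) ++ ending b))
             (sym first-assigns)
             (stepwise-decisions Inv ȳ laterYs (ending b) decide-y invariant (here refl , 1≤s ∷ [])
                                 ending-checked))
    where
    Inv : List Lit → Set
    Inv τ = lit 1 (not b) ∈ τ × All (λ ℓ → var ℓ ≤ s) τ

    decide-y : ∀ {τ v} → v ∈ laterYs → Inv τ → CheckedAt P F τ (step (dec (ȳ v)))
    decide-y v∈ (y∈τ , τ≤s) =
      checkedAt-dec {P = P} {d = ȳ _} (y∈P (there v∈))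
        (λ x x∈P _ → subst (_≤ lv P x) (sym (lv-y (there v∈))) (lvFrom-≥ 1 P x∈P))
        (tame-quiet tame y∈τ τ≤s)

    invariant : ∀ {τ v} → v ∈ laterYs → Inv τ → Inv (τ ++ ȳ v ∷ [])
    invariant v∈ (y∈τ , τ≤s) = ∈-++⁺ˡ y∈τ , All.++⁺ τ≤s (proj₂ (range1⁻ (there v∈)) ∷ [])

    lev-ord-w : ∀ x → x ∈ prefVars P → x ∉ map var (σy b) → lv P wv ≤ lv P x
    lev-ord-w x x∈P x∉σy = subst (_≤ lv P x) (sym lv-w)
      (lv-beyond-Ys x∈P (x∉σy ∘ subst (x ∈_) (sym (vars-σy b)) ∘ Ys⊆range1))

    ending-checked : Stepwise (CheckedAt P F) (σy b) (ending b)
    ending-checked =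
      checkedAt-dec {P = P} {d = w̄} w∈P lev-ord-w (tame-quiet tame (here refl) (σy-≤s b)) ,
      checkedAt-prop {P = P} isExist-t (M⊆F (tClause∈M b true)) (t-unit b)
        (tame-noConflict tame (here refl) (σw-≤s+1 b)) ,
      checkedAt-conflict {P = P} (M⊆F (tClause∈M b false)) (t̄-conflict b) ,
      tt

  red-tClause : ∀ b c → red P (tClause b c) ≡ tClause b c
  red-tClause b c = red-kept {P = P} {C = C} (tt ∷ w-kept ∷ t-kept ∷ [])
    where
    C = tClause b c
    w-kept : T (kept P C (lit wv true))
    w-kept = kept-dominated {P = P} {C = C} {ℓ = lit wv true} (there (there (here refl))) isExist-t
      (subst₂ _≤_ (sym lv-w) (sym lv-t) (s≤s (s≤s z≤n)))
    t-kept : T (kept P C (lit tv c))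
    t-kept = kept-existential {P = P} {C = C} {ℓ = lit tv c} isExist-t

  red-yw++yw : ∀ b → red P (yw b ++ yw b) ≡ lit 1 b ∷ lit 1 b ∷ []
  red-yw++yw b = begin
    red P (yw b ++ yw b)                       ≡⟨⟩
    lit 1 b ∷ filterᵇ K (w ∷ lit 1 b ∷ w ∷ []) ≡⟨ cong (lit 1 b ∷_) (drop-w (lit 1 b ∷ w ∷ [])) ⟩
    lit 1 b ∷ lit 1 b ∷ filterᵇ K (w ∷ [])     ≡⟨ cong (λ C → lit 1 b ∷ lit 1 b ∷ C) (drop-w []) ⟩
    lit 1 b ∷ lit 1 b ∷ []                     ∎
    where
    open ≡-Reasoning
    w : Lit
    w = lit wv true
    K : Lit → Bool
    K = kept P (yw b ++ yw b)
    w-∀ : ¬ Existential P w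
    w-∀ w-∃ = subst T (trans (sym w-∃) isExist-w) tt
    y<w : lv P 1 < lv P wv
    y<w = subst (1 <_) (sym lv-w) (s≤s (s≤s z≤n))
    below-w : ∀ {x} → x ∈ yw b ++ yw b → Existential P x → lv P (var x) < lv P wv
    below-w (here refl)                         _   = y<w
    below-w (there (here refl))                 w-∃ = ⊥-elim (w-∀ w-∃)
    below-w (there (there (here refl)))         _   = y<w
    below-w (there (there (there (here refl)))) w-∃ = ⊥-elim (w-∀ w-∃)
    drop-w : ∀ xs → filterᵇ K (w ∷ xs) ≡ filterᵇ K xs
    drop-w xs = filter-reject (T? ∘ K) {x = w} {xs = xs} (¬kept {P = P} {C = yw b ++ yw b} {ℓ = w} isExist-w below-w)

  resolved-on-t : ∀ b →
    (if neg t⁺ ∈ᵇ tClause b false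
     then red P (resolve t⁺ (tClause b false) (red P (tClause b true)))
     else tClause b false)
    ≡ lit 1 b ∷ lit 1 b ∷ []
  resolved-on-t b = begin
    (if neg t⁺ ∈ᵇ tClause b false then red P (resolve t⁺ (tClause b false) (red P (tClause b true)))
                                   else tClause b false)
      ≡⟨ cong (λ t̄∈ → if t̄∈ then red P (resolve t⁺ (tClause b false) (red P (tClause b true)))
                                  else tClause b false)
              (∈⇒∈ᵇ {ℓ = neg t⁺} {C = tClause b false} (there (there (here refl)))) ⟩
    red P (resolve t⁺ (tClause b false) (red P (tClause b true)))
      ≡⟨ cong (red P ∘ resolve t⁺ (tClause b false)) (red-tClause b true) ⟩
    red P (resolve t⁺ (tClause b false) (tClause b true))
      ≡⟨ cong (red P) (resolve-last t⁺ (yw b) (yw b) t̄∉yw t∉yw) ⟩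
    red P (yw b ++ yw b)
      ≡⟨ red-yw++yw b ⟩
    lit 1 b ∷ lit 1 b ∷ [] ∎
    where
    open ≡-Reasoning
    t̄∉yw : neg t⁺ ∉ yw b
    t̄∉yw (here ())
    t̄∉yw (there (here ()))
    t∉yw : t⁺ ∉ yw b
    t∉yw (here ())
    t∉yw (there (here t≡w)) = <⇒≢ w<t (sym (cong var t≡w))

  reverse-trapSteps : ∀ first b →
    reverse (first ∷ map (dec ∘ ȳ) laterYs ++ dec w̄ ∷ prop t⁺ (tClause b true) ∷ [])
    ≡ prop t⁺ (tClause b true) ∷ dec w̄ ∷ map (dec ∘ ȳ) (reverse laterYs) ++ first ∷ []
  reverse-trapSteps first b = begin
    reverse ((first ∷ D) ++ E)   ≡⟨ reverse-++ (first ∷ D) E ⟩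
    reverse E ++ reverse (first ∷ D) ≡⟨ cong (reverse E ++_) (unfold-reverse first D) ⟩
    reverse E ++ reverse D ++ first ∷ []
      ≡⟨ cong (λ R → reverse E ++ R ++ first ∷ []) (reverse-map (dec ∘ ȳ) laterYs) ⟨
    prop t⁺ (tClause b true) ∷ dec w̄ ∷ map (dec ∘ ȳ) (reverse laterYs) ++ first ∷ [] ∎
    where
    open ≡-Reasoning
    D = map (dec ∘ ȳ) laterYs
    E = dec w̄ ∷ prop t⁺ (tClause b true) ∷ []

  learnable-trapTrail : ∀ first b →
    learnable P (trapTrail first b) ≡ tClause b false ∷ learnGo P (lit 1 b ∷ lit 1 b ∷ []) (first ∷ [])
  learnable-trapTrail first b = begin
    learnGo P (red P (tClause b false)) (reverse (steps (trapTrail first b)))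
      ≡⟨ cong₂ (learnGo P) (red-tClause b false) (reverse-trapSteps first b) ⟩
    learnGo P (tClause b false)
      (prop t⁺ (tClause b true) ∷ dec w̄ ∷ map (dec ∘ ȳ) (reverse laterYs) ++ first ∷ [])
      ≡⟨ cong (tClause b false ∷_) (learnGo-decisions P _ ȳ (reverse laterYs) (first ∷ [])) ⟩
    tClause b false ∷ learnGo P _ (first ∷ [])
      ≡⟨ cong (λ C → tClause b false ∷ learnGo P C (first ∷ [])) (resolved-on-t b) ⟩
    tClause b false ∷ learnGo P (lit 1 b ∷ lit 1 b ∷ []) (first ∷ []) ∎
    where open ≡-Reasoning

  C₁ : Clause
  C₁ = lit 1 true ∷ lit 1 true ∷ []

  T₁ T₂ : Trail
  T₁ = trapTrail (dec (lit 1 false)) true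
  T₂ = trapTrail (prop (lit 1 true) C₁) false

  natural₁ : NaturalTrail P M T₁
  natural₁ = trapTrail-natural (dec (lit 1 false)) (inj₁ ∘ matrix-twoLate) id refl
    (checkedAt-dec {P = P} {d = lit 1 false} (y∈P (here refl)) (λ x x∈P _ → lvFrom-≥ 1 P x∈P)
      (λ C∈M → twoLate⇒¬UnitUnder {P = P} (matrix-twoLate C∈M) []))

  natural₂ : NaturalTrail P (M ++ C₁ ∷ []) T₂
  natural₂ = trapTrail-natural (prop (lit 1 true) C₁) tame ∈-++⁺ˡ refl
    (checkedAt-prop {P = P} {F = M ++ C₁ ∷ []} refl (∈-++⁺ʳ M (here refl)) y-unit no-conflict)
    where
    tame : Tame false (M ++ C₁ ∷ [])
    tame C∈ with ∈-++⁻ M C∈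
    ... | inj₁ C∈M        = inj₁ (matrix-twoLate C∈M)
    ... | inj₂ (here refl) = inj₂ (here refl)
    y-unit : RestrictsTo C₁ [] (lit 1 true)
    y-unit = restrictsTo-intro ((λ ()) ∷ (λ ()) ∷ []) (here refl) (λ ())
      λ { (here refl) → inj₁ refl ; (there (here refl)) → inj₁ refl }
    no-conflict : NoConflict (M ++ C₁ ∷ []) []
    no-conflict C∈ with ∈-++⁻ M C∈
    ... | inj₁ C∈M        = twoLate⇒¬RestrictsEmpty (matrix-twoLate C∈M) []
    ... | inj₂ (here refl) = open⇒¬RestrictsEmpty (here refl) (λ ())

  refutation : IsRefutation (Trapdoor (2 + k)) ((T₁ , C₁) ∷ (T₂ , []) ∷ [])
  refutation = refutation₂ natural₁
    (subst (C₁ ∈_) (sym (learnable-trapTrail (dec (lit 1 false)) true)) (there (here refl)))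
    natural₂
    -- Resolving (ȳ₁ ∨ ȳ₁) with the antecedent (y₁ ∨ y₁) of y₁ is left to evaluation.
    (subst ([] ∈_) (sym (learnable-trapTrail (prop (lit 1 true) C₁) false)) (there (there (here refl))))

  tlen-trapTrail : ∀ first b → tlen (trapTrail first b) ≡ s + 3
  tlen-trapTrail first b = begin
    length (elems (trapTrail first b))     ≡⟨ cong length (elems-trapTrail first b) ⟩
    suc (length (map step D ++ ending b))  ≡⟨ cong suc (length-++ (map step D)) ⟩
    suc (length (map step D) + 3)          ≡⟨ cong (λ m → suc (m + 3)) count ⟩
    s + 3                                  ∎
    where
    open ≡-Reasoning
    D = map (dec ∘ ȳ) laterYs
    count : length (map step D) ≡ pred s
    count = trans (length-map step D) (trans (length-map (dec ∘ ȳ) laterYs)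
              (trans (length-map suc (applyUpTo suc (pred s))) (length-applyUpTo suc (pred s))))

  size-refutation : size ((T₁ , C₁) ∷ (T₂ , []) ∷ []) ≡ 2 * (s + 3)
  size-refutation = cong₂ (λ l₁ l₂ → l₁ + (l₂ + 0))
    (tlen-trapTrail (dec (lit 1 false)) true) (tlen-trapTrail (prop (lit 1 true) C₁) false)

module TrapdoorRefutation1 where

  P₁ : Prefix
  P₁ = prefix (Trapdoor 1)

  M₁ : CNF
  M₁ = matrix (Trapdoor 1)

  x₁ x₂ : Lit
  x₁ = lit (TrapVars.xv 1 1) true
  x₂ = lit (TrapVars.xv 1 2) true

  trail₁ : Trail
  trail₁ = trail (prop x₁ (x₁ ∷ []) ∷ prop x₂ (x₂ ∷ []) ∷ []) (neg x₂ ∷ neg x₁ ∷ [])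

  natural : NaturalTrail P₁ M₁ trail₁
  natural =
    ((λ ()) ∷ []) ∷ [] ∷ [] ,
    checkedAt-prop {P = P₁} {F = M₁} refl (here refl) x₁-unit (noConflict-by-evaluation refl) ,
    checkedAt-prop {P = P₁} {F = M₁} refl (there (here refl)) x₂-unit (noConflict-by-evaluation refl) ,
    checkedAt-conflict {P = P₁} {F = M₁} (there (there (here refl))) (All¬⇒¬Any (x̄₂∉ ∷ x̄₁∉ ∷ []) , falsified) ,
    tt
    where
    x₁-unit : RestrictsTo (x₁ ∷ []) [] x₁
    x₁-unit = restrictsTo-intro ((λ ()) ∷ []) (here refl) (λ ()) λ { (here refl) → inj₁ refl }
    x₂-unit : RestrictsTo (x₂ ∷ []) (x₁ ∷ []) x₂
    x₂-unit = restrictsTo-intro ((λ { (here ()) }) ∷ []) (here refl) (λ { (here ()) })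
      λ { (here refl) → inj₁ refl }
    x̄₂∉ : neg x₂ ∉ x₁ ∷ x₂ ∷ []
    x̄₂∉ (here ())
    x̄₂∉ (there (here ()))
    x̄₁∉ : neg x₁ ∉ x₁ ∷ x₂ ∷ []
    x̄₁∉ (here ())
    x̄₁∉ (there (here ()))
    falsified : ∀ ℓ → ℓ ∈ neg x₂ ∷ neg x₁ ∷ [] → neg ℓ ∈ x₁ ∷ x₂ ∷ []
    falsified _ (here refl)         = there (here refl)
    falsified _ (there (here refl)) = here refl

  refutation : IsRefutation (Trapdoor 1) ((trail₁ , []) ∷ [])
  refutation = refutation₁ natural (there (there (here refl)))

refutation-size-bound : ∀ m → 2 * (sn (suc m) + 3) ≤ 10 * suc m ^ 2
refutation-size-bound m = subst (2 * (sn (suc m) + 3) ≤_) (sym (expansion m)) (m≤m+n _ _)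
  where
  -- suc m ^ 2 unfolded, so that the solver meets only + and *.
  expansion : ∀ m → 10 * ((1 + m) * ((1 + m) * 1)) ≡ 2 * ((1 + m) * ((1 + m) + 1) + 3) + (8 * (m * m) + 14 * m)
  expansion = solve-∀

proposition8p3 : ∃[ c ] ∃[ k ] (∀ (n : ℕ) → 1 ≤ n →
    ∃[ R ] (IsRefutation (Trapdoor n) R × size R ≤ c * n ^ k))
proposition8p3 = 10 , 2 , refutes
  where
  refutes : ∀ n → 1 ≤ n → ∃[ R ] (IsRefutation (Trapdoor n) R × size R ≤ 10 * n ^ 2)
  refutes 1             _ = _ , TrapdoorRefutation1.refutation , s≤s (s≤s (s≤s z≤n))
  refutes (suc (suc k)) _ = _ , refutation ,
    subst (_≤ 10 * (2 + k) ^ 2) (sym size-refutation) (refutation-size-bound (suc k))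
    where open TrapdoorRefutation≥2 k
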